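{- Let $\{\alpha_{n,k}\}_{n,k\in\mathbb{Z}}$ and $\{\beta_{n,k}\}_{n,k\in\mathbb{Z}}$ be double-indexed sequences of complex numbers with $\alpha_{n,n}\neq 0$ for all $n$ and $\beta_{n,k}=-\beta_{k,n}$ for all $n,k$. Then $$\alpha_{n,p}\beta_{q,k}+\alpha_{n,q}\beta_{k,p}+\alpha_{n,k}\beta_{p,q}=0\quad\text{for all integers }n,k,p,q$$ holds if and only if $$\alpha_{p,x}\beta_{y,p}+\alpha_{p,y}\beta_{p,x}+\alpha_{p,p}\beta_{x,y}=0\quad\text{for all integers }x,p,y.$$ -}

module Defs where

open import Level using (Level; _⊔_; suc)
open import Algebra.Bundles using (CommutativeRing)
open import Data.Product using (∃)
open import Relation.Nullary using (¬_)

record Field (c ℓ : Level) : Set (suc (c ⊔ ℓ)) where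
  field
    commutativeRing : CommutativeRing c ℓ
  open CommutativeRing commutativeRing public
  field
    0≉1     : ¬ (0# ≈ 1#)
    inverse : ∀ x → ¬ (x ≈ 0#) → ∃ λ y → (x * y) ≈ 1#

-- Take n as a pivot and write H x y for the relation at (n, n, x, y).  The
-- combination α n p · H q k + α n q · H k p + α n k · H p q equals
-- α n n times the three-term sum at (n, k, p, q), plus three multiples of
-- β x n + β n x.  All H vanish by hypothesis and all β x n + β n x by
-- antisymmetry, so α n n kills the sum, and α n n is invertible.
module Submission where

open import Defs
open import Data.Integer using (ℤ)
open import Data.Product using (_×_; _,_)
open import Relation.Nullary using (¬_)
open import Algebra.Bundles using (CommutativeSemiring; CommutativeRing)
import Algebra.Properties.CommutativeSemigroup as CommutativeSemigroupProperties
import Algebra.Solver.Ring.NaturalCoefficients.Default as SemiringSolver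
import Relation.Binary.Reasoning.Setoid as SetoidReasoning

module ThreeTerm {c ℓ} (S : CommutativeSemiring c ℓ) {I : Set}
                 (α β : I → I → CommutativeSemiring.Carrier S) where
  open CommutativeSemiring S
  open SemiringSolver S using (solve; _:+_; _:*_; _:=_)

  threeTermSum : I → I → I → I → Carrier
  threeTermSum n k p q = (α n p * β q k + α n q * β k p) + α n k * β p q

  -- Stated without subtraction: as a semiring identity it is within reach of the
  -- ℕ-coefficient solver, which needs no decidable equality on the carrier.
  pivot-combination : ∀ n k p q →
    (α n p * threeTermSum n n q k + α n q * threeTermSum n n k p) + α n k * threeTermSum n n p q
    ≈ α n n * threeTermSum n k p q
      + ((α n p * α n q * (β k n + β n k) + α n p * α n k * (β q n + β n q))
         + α n q * α n k * (β p n + β n p))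
  pivot-combination n k p q = solve 13
    (λ ann anp anq ank bqk bkp bpq bkn bnk bqn bnq bpn bnp →
      (anp :* ((anq :* bkn :+ ank :* bnq) :+ ann :* bqk)
        :+ anq :* ((ank :* bpn :+ anp :* bnk) :+ ann :* bkp))
        :+ ank :* ((anp :* bqn :+ anq :* bnp) :+ ann :* bpq)
      := ann :* ((anp :* bqk :+ anq :* bkp) :+ ank :* bpq)
         :+ ((anp :* anq :* (bkn :+ bnk) :+ anp :* ank :* (bqn :+ bnq))
            :+ anq :* ank :* (bpn :+ bnp)))
    refl (α n n) (α n p) (α n q) (α n k) (β q k) (β k p) (β p q)
         (β k n) (β n k) (β q n) (β n q) (β p n) (β n p)

module _ {c ℓ} (R : CommutativeRing c ℓ) where
  open CommutativeRing R
  open SetoidReasoning setoid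
  open CommutativeSemigroupProperties *-commutativeSemigroup using (xy∙z≈y∙xz)
  open ThreeTerm commutativeSemiring

  x*y≈1⇒x*z≈0⇒z≈0 : ∀ {x y z} → x * y ≈ 1# → x * z ≈ 0# → z ≈ 0#
  x*y≈1⇒x*z≈0⇒z≈0 {x} {y} {z} xy≈1 xz≈0 = begin
    z            ≈⟨ *-identityˡ z ⟨
    1# * z       ≈⟨ *-congʳ xy≈1 ⟨
    (x * y) * z  ≈⟨ xy∙z≈y∙xz x y z ⟩
    y * (x * z)  ≈⟨ *-congˡ xz≈0 ⟩
    y * 0#       ≈⟨ zeroʳ y ⟩
    0#           ∎

  pivot*threeTermSum≈0 : ∀ {I : Set} (α β : I → I → Carrier) →
    (∀ x y → β x y ≈ - β y x) → ∀ n → (∀ x y → threeTermSum α β n n x y ≈ 0#) →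
    ∀ k p q → α n n * threeTermSum α β n k p q ≈ 0#
  pivot*threeTermSum≈0 α β antisym n pivot k p q = begin
    α n n * threeTermSum α β n k p q
      ≈⟨ +-identityʳ _ ⟨
    α n n * threeTermSum α β n k p q + 0#
      ≈⟨ +-congˡ symmetric-parts≈0 ⟨
    α n n * threeTermSum α β n k p q
      + ((α n p * α n q * (β k n + β n k) + α n p * α n k * (β q n + β n q))
         + α n q * α n k * (β p n + β n p))
      ≈⟨ pivot-combination α β n k p q ⟨
    (α n p * threeTermSum α β n n q k + α n q * threeTermSum α β n n k p)
      + α n k * threeTermSum α β n n p q
      ≈⟨ +-cong (+-cong (≈0⇒*≈0 (pivot q k)) (≈0⇒*≈0 (pivot k p))) (≈0⇒*≈0 (pivot p q)) ⟩
    (0# + 0#) + 0#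
      ≈⟨ 0+0+0≈0 ⟩
    0# ∎
    where
    ≈0⇒*≈0 : ∀ {a t} → t ≈ 0# → a * t ≈ 0#
    ≈0⇒*≈0 {a} t≈0 = trans (*-congˡ t≈0) (zeroʳ a)

    0+0+0≈0 : (0# + 0#) + 0# ≈ 0#
    0+0+0≈0 = trans (+-identityʳ _) (+-identityʳ 0#)

    symmetric-part≈0 : ∀ {a} x → a * (β x n + β n x) ≈ 0#
    symmetric-part≈0 x = ≈0⇒*≈0 (trans (+-congʳ (antisym x n)) (-‿inverseˡ (β n x)))

    symmetric-parts≈0 : (α n p * α n q * (β k n + β n k) + α n p * α n k * (β q n + β n q))
                        + α n q * α n k * (β p n + β n p) ≈ 0#
    symmetric-parts≈0 = trans (+-cong (+-cong (symmetric-part≈0 k) (symmetric-part≈0 q))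
                                      (symmetric-part≈0 p)) 0+0+0≈0

lemma3p3 : ∀ {c ℓ} (K : Field c ℓ) → let open Field K in
    (α β : ℤ → ℤ → Carrier) →
    (∀ n → ¬ (α n n ≈ 0#)) →
    (∀ n k → β n k ≈ - β k n) →
    ((∀ n k p q → (α n p * β q k + α n q * β k p) + α n k * β p q ≈ 0#) →
      (∀ x p y → (α p x * β y p + α p y * β p x) + α p p * β x y ≈ 0#))
    × ((∀ x p y → (α p x * β y p + α p y * β p x) + α p p * β x y ≈ 0#) →
      (∀ n k p q → (α n p * β q k + α n q * β k p) + α n k * β p q ≈ 0#))
lemma3p3 K α β α-diag≉0 antisym = (λ all x p y → all p p x y) , fromPivots
  where
  open Field K
  open ThreeTerm commutativeSemiring α β
  fromPivots : (∀ x p y → threeTermSum p p x y ≈ 0#) → ∀ n k p q → threeTermSum n k p q ≈ 0#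
  fromPivots pivots n k p q with inverse (α n n) (α-diag≉0 n)
  ... | _ , αnn*y≈1 = x*y≈1⇒x*z≈0⇒z≈0 commutativeRing αnn*y≈1
        (pivot*threeTermSum≈0 commutativeRing α β antisym n (λ x y → pivots x n y) k p q)
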